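{- Let $B$ be a positive integer, $\xi,\delta$ reals with $2/3<\xi<1$, $0<\delta<\xi/2$, and $\mu$ a measure on $\mathbb{Z}^2$. Consider a rectangle made of a grid of colonies (cells) of size $B$; its rows are horizontal runs and its columns are vertical runs of cells. Let $R$ be a clean row of the rectangle. Then there are at most $3$ clean columns of the rectangle that do not intersect $R$ securely.
   Context: A colony (cell) of size $B$ is a $B\times B$ square of points of $\mathbb{Z}^2$ whose corner coordinates are multiples of $B$. A run is a union $U=U_1\cup\dots\cup U_n$ of cells consecutively (all horizontally or all vertically) adjacent. A run is safe if $\mu(U)<\xi B$ and, for real $i$, $i$-good if $\mu(U)<(1-i\delta)B$. The obstacle of a run is a cell of largest weight in it (say the first). A run is step-clean if every two consecutive cells of it form a safe run; unimodal if the runs on both sides of the obstacle are step-clean; clean if it is unimodal and every three consecutive cells form a $1$-good run. In a run $U_1\cup\dots\cup U_n$, the cell $U_i$ is secure if $U_{i-1}\cup U_i$ is safe (when $i>1$) and $U_i\cup U_{i+1}$ is safe (when $i<n$). A horizontal run and a vertical run intersect securely if their intersection cell is secure either in the horizontal run or in the vertical run. -}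

module Defs where

open import Level using (Level; _⊔_) renaming (suc to lsuc)
open import Relation.Binary.PropositionalEquality using (_≡_)
open import Data.Nat as ℕ using (ℕ; zero; suc)
open import Data.Integer as ℤ using (ℤ; +_)
open import Data.Product using (_×_; _,_; ∃-syntax)
open import Data.Sum using (_⊎_)

-- The paper uses the reals (with measure values in [0,∞]); the only
-- structure needed to *state* the lemma is addition, multiplication,
-- 0, 1 and the orders < and ≤.  The lemma is stated for every such
-- structure, in particular for ℝ (or [0,∞]) with the usual operations.
record Scalars (c ℓ : Level) : Set (lsuc (c ⊔ ℓ)) where
  infixl 6 _+_
  infixl 7 _*_
  infix 4 _<_ _≤_
  field
    Carrier : Set c
    _+_ _*_ : Carrier → Carrier → Carrier
    0# 1#   : Carrier
    _<_ _≤_ : Carrier → Carrier → Set ℓ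

  fromℕ : ℕ → Carrier
  fromℕ zero    = 0#
  fromℕ (suc n) = 1# + fromℕ n

-- Index of a cell (colony) of size B: cell (a , b) is the B×B square of
-- points {(a*B + x , b*B + y) | 0 ≤ x,y < B} of ℤ², whose corner
-- coordinates are multiples of B.
Cell : Set
Cell = ℤ × ℤ

-- A run of n cells is given by a map ℕ → Cell of which the entries
-- 0 … n-1 are used (U_1 … U_n in the paper are entries 0 … n-1 here).
RunF : Set
RunF = ℕ → Cell

module Colonies {c ℓ} (S : Scalars c ℓ) (B : ℕ) (ξ δ : Scalars.Carrier S)
                (μ : ℤ × ℤ → Scalars.Carrier S) where
  open Scalars S

  sumTo : ℕ → (ℕ → Carrier) → Carrier
  sumTo zero    f = 0#
  sumTo (suc l) f = sumTo l f + f l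

  cellWeight : Cell → Carrier
  cellWeight (a , b) =
    sumTo B (λ x → sumTo B (λ y →
      μ ((a ℤ.* + B) ℤ.+ + x , (b ℤ.* + B) ℤ.+ + y)))

  -- μ of the sub-run U_i ∪ … ∪ U_{i+l-1} (0-based) of the run f
  weight : RunF → ℕ → ℕ → Carrier
  weight f i l = sumTo l (λ t → cellWeight (f (i ℕ.+ t)))

  Safe : RunF → ℕ → ℕ → Set ℓ
  Safe f i l = weight f i l < ξ * fromℕ B

  -- the sub-run is 1-good: μ(U) < (1 - δ) B, written μ(U) + δ B < B
  Good1 : RunF → ℕ → ℕ → Set ℓ
  Good1 f i l = weight f i l + δ * fromℕ B < fromℕ B

  StepCleanOn : RunF → ℕ → ℕ → Set ℓ
  StepCleanOn f a b = ∀ i → a ℕ.≤ i → suc i ℕ.< b → Safe f i 2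

  IsObstacle : RunF → ℕ → ℕ → Set ℓ
  IsObstacle f n k =
    k ℕ.< n
    × (∀ j → j ℕ.< n → cellWeight (f j) ≤ cellWeight (f k))
    × (∀ j → j ℕ.< k → cellWeight (f j) < cellWeight (f k))

  Unimodal : RunF → ℕ → Set ℓ
  Unimodal f n =
    ∃[ k ] (IsObstacle f n k × StepCleanOn f 0 k × StepCleanOn f (suc k) n)

  Clean : RunF → ℕ → Set ℓ
  Clean f n = Unimodal f n × (∀ i → i ℕ.+ 2 ℕ.< n → Good1 f i 3)

  Secure : RunF → ℕ → ℕ → Set ℓ
  Secure f n i =
    (∀ j → suc j ≡ i → Safe f j 2) × (suc i ℕ.< n → Safe f i 2)

  -- Rectangle of m columns and n rows of cells with lower-left cell (a₀ , b₀).
  -- Row r (r < n): horizontal run of the m cells (a₀ + j , b₀ + r), j < m.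
  row : ℤ → ℤ → ℕ → RunF
  row a₀ b₀ r j = (a₀ ℤ.+ + j , b₀ ℤ.+ + r)

  col : ℤ → ℤ → ℕ → RunF
  col a₀ b₀ c i = (a₀ ℤ.+ + c , b₀ ℤ.+ + i)

  IntersectSecurely : ℤ → ℤ → ℕ → ℕ → ℕ → ℕ → Set ℓ
  IntersectSecurely a₀ b₀ m n r c =
    Secure (row a₀ b₀ r) m c ⊎ Secure (col a₀ b₀ c) n r

-- On either side of the obstacle of a unimodal run every two-cell run is safe,
-- so a cell of the run can be insecure only if it is the obstacle or one of its
-- two neighbours.  Distinct columns meet the clean row R in distinct cells, and
-- a column that does not meet R securely meets it in an insecure cell of R;
-- hence there are at most three such columns.
module Submission where

open import Defs
open import Data.Nat using (ℕ; _<_; _≤_; _+_; suc; _∸_; s≤s; s≤s⁻¹; z≤n)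
open import Data.Nat.Properties
  using (<-cmp; ≤-antisym; ≮⇒≥; <⇒≤; <-trans; n<1+n; +-suc; module ≤-Reasoning)
open import Data.Integer using (ℤ)
open import Data.Empty using (⊥-elim)
open import Data.Product using (_×_; _,_)
open import Data.Sum using (inj₁; inj₂)
open import Data.List using (List; []; _∷_; _++_; length)
open import Data.List.Properties using (length-++)
open import Data.List.Relation.Unary.All as All using (All)
open import Data.List.Relation.Unary.AllPairs using (_∷_)
open import Data.List.Relation.Unary.Any using (here; there)
open import Data.List.Relation.Unary.Unique.Propositional using (Unique)
open import Data.List.Membership.Propositional using (_∈_)
open import Data.List.Membership.Propositional.Properties using (∈-∃++; ∈-++⁻; ∈-++⁺ˡ; ∈-++⁺ʳ)
open import Data.List.Relation.Binary.Subset.Propositional using (_⊆_)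
open import Relation.Binary.Definitions using (tri<; tri≈; tri>)
open import Relation.Binary.PropositionalEquality using (_≢_; refl; sym; cong)
open import Relation.Nullary using (¬_)

module _ {a} {A : Set a} where

  ∈-++-skip : ∀ {x z : A} us vs → z ≢ x → z ∈ us ++ x ∷ vs → z ∈ us ++ vs
  ∈-++-skip us vs z≢x z∈ with ∈-++⁻ us z∈
  ... | inj₁ z∈us         = ∈-++⁺ˡ z∈us
  ... | inj₂ (here z≡x)   = ⊥-elim (z≢x z≡x)
  ... | inj₂ (there z∈vs) = ∈-++⁺ʳ us z∈vs

  Unique-⊆⇒length≤ : ∀ {xs ys : List A} → Unique xs → xs ⊆ ys → length xs ≤ length ys
  Unique-⊆⇒length≤ {[]}     _                _   = z≤n
  Unique-⊆⇒length≤ {x ∷ xs} (x∉xs ∷ unique) sub with ∈-∃++ (sub (here refl))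
  ... | us , vs , refl = begin
    suc (length xs)             ≤⟨ s≤s (Unique-⊆⇒length≤ unique shrink) ⟩
    suc (length (us ++ vs))     ≡⟨ cong suc (length-++ us) ⟩
    suc (length us + length vs) ≡⟨ sym (+-suc (length us) (length vs)) ⟩
    length us + length (x ∷ vs) ≡⟨ sym (length-++ us) ⟩
    length (us ++ x ∷ vs)       ∎
    where
    open ≤-Reasoning
    shrink : xs ⊆ us ++ vs
    shrink z∈xs = ∈-++-skip us vs (λ z≡x → All.lookup x∉xs z∈xs (sym z≡x)) (sub (there z∈xs))

neighbour-of-obstacle : ∀ {k c} → k ≤ suc c → c ≤ suc k → c ∈ k ∸ 1 ∷ k ∷ suc k ∷ []
neighbour-of-obstacle {k} {c} k≤1+c c≤1+k with <-cmp c k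
... | tri< c<k _ _ = here (cong (_∸ 1) (≤-antisym c<k k≤1+c))
... | tri≈ _ c≡k _ = there (here c≡k)
... | tri> _ _ k<c = there (there (here (≤-antisym c≤1+k k<c)))

module _ {c ℓ} (S : Scalars c ℓ) (B : ℕ) (ξ δ : Scalars.Carrier S)
         (μ : ℤ × ℤ → Scalars.Carrier S) where
  open Colonies S B ξ δ μ

  secure-before : ∀ {f m k i} → StepCleanOn f 0 k → suc i < k → Secure f m i
  secure-before {i = i} stepClean 1+i<k =
    (λ { j refl → stepClean j z≤n (<-trans (n<1+n i) 1+i<k) }) ,
    (λ _ → stepClean i z≤n 1+i<k)

  secure-after : ∀ {f m k i} → StepCleanOn f (suc k) m → suc k < i → i < m → Secure f m i
  secure-after stepClean 1+k<i i<m =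
    (λ { j refl → stepClean j (s≤s⁻¹ 1+k<i) i<m }) ,
    (λ 1+i<m → stepClean _ (<⇒≤ 1+k<i) 1+i<m)

  insecure⇒neighbour-of-obstacle :
    ∀ f {m k i} → StepCleanOn f 0 k → StepCleanOn f (suc k) m →
    i < m → ¬ Secure f m i → i ∈ k ∸ 1 ∷ k ∷ suc k ∷ []
  insecure⇒neighbour-of-obstacle f before after i<m insecure =
    neighbour-of-obstacle
      (≮⇒≥ (λ 1+i<k → insecure (secure-before {f} before 1+i<k)))
      (≮⇒≥ (λ 1+k<i → insecure (secure-after {f} after 1+k<i i<m)))

lemma4p5 : ∀ {c ℓ} (S : Scalars c ℓ) (B : ℕ) (ξ δ : Scalars.Carrier S)
             (μ : ℤ × ℤ → Scalars.Carrier S) →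
           0 < B →
           Scalars._<_ S (Scalars.fromℕ S 2) (Scalars._*_ S (Scalars.fromℕ S 3) ξ) →
           Scalars._<_ S ξ (Scalars.1# S) →
           Scalars._<_ S (Scalars.0# S) δ →
           Scalars._<_ S (Scalars._*_ S (Scalars.fromℕ S 2) δ) ξ →
           (∀ p → Scalars._≤_ S (Scalars.0# S) (μ p)) →
           (a₀ b₀ : ℤ) (m n : ℕ) (r : ℕ) → r < n →
           Colonies.Clean S B ξ δ μ (Colonies.row S B ξ δ μ a₀ b₀ r) m →
           (cs : List ℕ) → Unique cs →
           All (λ c → c < m
                      × Colonies.Clean S B ξ δ μ (Colonies.col S B ξ δ μ a₀ b₀ c) n
                      × ¬ Colonies.IntersectSecurely S B ξ δ μ a₀ b₀ m n r c) cs →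
           length cs ≤ 3
lemma4p5 S B ξ δ μ _ _ _ _ _ _ a₀ b₀ m n r _ ((k , _ , before , after) , _) cs unique columns =
  Unique-⊆⇒length≤ unique (λ c∈cs → meets-near-obstacle (All.lookup columns c∈cs))
  where
  open Colonies S B ξ δ μ
  meets-near-obstacle : ∀ {c} → c < m × Clean (col a₀ b₀ c) n × ¬ IntersectSecurely a₀ b₀ m n r c →
                        c ∈ k ∸ 1 ∷ k ∷ suc k ∷ []
  meets-near-obstacle (c<m , _ , insecure) =
    insecure⇒neighbour-of-obstacle S B ξ δ μ (row a₀ b₀ r) before after c<m (λ secure → insecure (inj₁ secure))
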